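{- Let $d \ge 1$ be an integer and let $A_d$ be the adjacency matrix of the graph $\Gamma_d$. Then $A_d$ is invertible and $$A_d^{ -1} = W_{3d-1} - \frac{1}{d} J_{3d-1}.$$
   Context: For an integer $d \ge 1$, $\Gamma_d$ is the graph on vertex set $[3d-1]$ whose edges are all pairs $\{i, i+3t+1\}$ for $i \in [3d-1]$ and $0 \le t \le \lceil d/2\rceil - 1$, with labels taken modulo $3d-1$ (so the edges are $\{i,i+1\},\{i,i+4\},\ldots,\{i,i+3\lceil d/2\rceil-2\}$); it is $d$-regular. For an integer $m$, $J_m$ is the $m\times m$ all-ones matrix and $W_m = I_m + P_m + P_m^{T}$, where $P_m$ is the permutation matrix of the cyclic shift $i \mapsto i+1 \pmod m$; for $m \ge 3$, $W_m$ is the $0/1$ circulant matrix with $W_m(i,j) = 1$ iff $j - i \equiv -1, 0, 1 \pmod m$. -}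

module Defs where

open import Data.Nat as ℕ using (ℕ; zero; suc; _∸_; ⌈_/2⌉; NonZero)
open import Data.Nat.DivMod using (_%_)
open import Data.Bool using (Bool; true; false; _∨_; if_then_else_)
open import Data.Fin using (Fin; toℕ)
open import Data.List using (List; upTo)
open import Data.Bool.ListAction using (any)
open import Data.Integer using (+_)
open import Relation.Nullary.Decidable using (⌊_⌋)
open import Data.Rational using (ℚ; 0ℚ; 1ℚ; _+_; _-_; _*_; _/_)

-- Matrices over ℚ, as functions of (row, column).
Mat : ℕ → Set
Mat n = Fin n → Fin n → ℚ

sumFin : (n : ℕ) → (Fin n → ℚ) → ℚ
sumFin zero    f = 0ℚ
sumFin (suc n) f = f Fin.zero + sumFin n (λ i → f (Fin.suc i))
  where import Data.Fin as Fin

_⊗_ : {n : ℕ} → Mat n → Mat n → Mat n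
_⊗_ {n} A B i j = sumFin n (λ k → A i k * B k j)

_⊕_ : {n : ℕ} → Mat n → Mat n → Mat n
(A ⊕ B) i j = A i j + B i j

_⊖_ : {n : ℕ} → Mat n → Mat n → Mat n
(A ⊖ B) i j = A i j - B i j

_ᵀ : {n : ℕ} → Mat n → Mat n
(A ᵀ) i j = A j i

_·_ : {n : ℕ} → ℚ → Mat n → Mat n
(c · A) i j = c * A i j

boolℚ : Bool → ℚ
boolℚ b = if b then 1ℚ else 0ℚ

-- x mod m (with x mod 0 = x; only used for m ≥ 1)
_mod_ : ℕ → ℕ → ℕ
x mod zero  = x
x mod suc m = x % suc m

Id : (m : ℕ) → Mat m
Id m i j = boolℚ ⌊ toℕ i ℕ.≟ toℕ j ⌋

J : (m : ℕ) → Mat m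
J m i j = 1ℚ

P : (m : ℕ) → Mat m
P m i j = boolℚ ⌊ (suc (toℕ i)) mod m ℕ.≟ toℕ j ⌋

W : (m : ℕ) → Mat m
W m = (Id m ⊕ P m) ⊕ (P m ᵀ)

N : ℕ → ℕ
N d = 3 ℕ.* d ∸ 1

edgeΓ : (d : ℕ) → Fin (N d) → Fin (N d) → Bool
edgeΓ d i j = any (λ t → ⌊ (toℕ i ℕ.+ (3 ℕ.* t ℕ.+ 1)) mod N d ℕ.≟ toℕ j ⌋
                       ∨ ⌊ (toℕ j ℕ.+ (3 ℕ.* t ℕ.+ 1)) mod N d ℕ.≟ toℕ i ⌋)
                  (upTo ⌈ d /2⌉)

A : (d : ℕ) → Mat (N d)
A d i j = boolℚ (edgeΓ d i j)

Ainv : (d : ℕ) .{{_ : NonZero d}} → Mat (N d)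
Ainv d = W (N d) ⊖ ((+ 1 / d) · J (N d))

{-# OPTIONS --safe #-}
module Submission where

-- Γ_d is a circulant graph: i ~ k iff the offset k − i (mod 3d − 1) is ≡ 1 (mod 3), because the
-- offsets 3t + 1 (t < ⌈d/2⌉) and their negatives 3(d − 1 − t) + 1 together cover all such residues.
-- So (A W)(i, j) counts the residues ≡ 1 (mod 3) among r − 1, r, r + 1 for r = j − i.  This is 1,
-- except at r = 0, where both 1 and −1 ≡ 3d − 2 count: A W = J + I.  Since every row of W sums to
-- 3, comparing row sums gives 3 · deg = 3d, hence A J = d J and A (W − J/d) = I.  A and W − J/d are
-- symmetric, so the product in the other order is the transpose of this one.

open import Defs
open import Data.Nat using (ℕ; NonZero)
open import Data.Product using (_×_)
open import Relation.Binary.PropositionalEquality using (_≡_)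

open import Data.Bool using (Bool; T)
open import Data.Bool.Properties using (T-≡; ⇔→≡)
open import Data.Bool.ListAction using (any)
open import Data.List using (upTo)
open import Data.List.Relation.Unary.Any.Properties using (any⁺; any⁻; applyUpTo⁺; applyUpTo⁻)
open import Data.Product using (∃-syntax; _,_)
open import Function.Base using (id)
open import Function.Bundles using (_⇔_; mk⇔; Equivalence)
open import Function.Construct.Composition using (_⇔-∘_)
open import Function.Construct.Symmetry using (⇔-sym)
open import Relation.Binary.PropositionalEquality using (sym; trans)
open import Relation.Nullary.Decidable using (Dec; ⌊_⌋; toWitness; fromWitness; isYes≗does; does-⇔)
import Data.Nat as ℕ

T-⌊≟⌋ : ∀ {x y : ℕ} → T ⌊ x ℕ.≟ y ⌋ ⇔ (x ≡ y)
T-⌊≟⌋ = mk⇔ toWitness fromWitness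

⌊⌋-⇔ : ∀ {a b} {A : Set a} {B : Set b} → A ⇔ B →
       (a? : Dec A) (b? : Dec B) → ⌊ a? ⌋ ≡ ⌊ b? ⌋
⌊⌋-⇔ A⇔B a? b? = trans (isYes≗does a?) (trans (does-⇔ A⇔B a? b?) (sym (isYes≗does b?)))

T-⇔⇒≡ : ∀ {x y} → T x ⇔ T y → x ≡ y
T-⇔⇒≡ Tx⇔Ty = ⇔→≡ (T-≡ ⇔-∘ (Tx⇔Ty ⇔-∘ ⇔-sym T-≡))

≡-sym-⇔ : ∀ {a} {A : Set a} {x y : A} → (x ≡ y) ⇔ (y ≡ x)
≡-sym-⇔ = mk⇔ sym sym

T-any-upTo : ∀ (p : ℕ → Bool) c → T (any p (upTo c)) ⇔ (∃[ t ] t ℕ.< c × T (p t))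
T-any-upTo p c = mk⇔ (λ h → applyUpTo⁻ id (any⁻ p (upTo c) h))
                     (λ (t , t<c , pt) → any⁺ p (applyUpTo⁺ id pt t<c))

∃<-cong : ∀ {c} {P Q : ℕ → Set} → (∀ {t} → t ℕ.< c → P t ⇔ Q t) →
          (∃[ t ] t ℕ.< c × P t) ⇔ (∃[ t ] t ℕ.< c × Q t)
∃<-cong P⇔Q = mk⇔ (λ (t , t<c , pt) → t , t<c , Equivalence.to (P⇔Q t<c) pt)
                  (λ (t , t<c , qt) → t , t<c , Equivalence.from (P⇔Q t<c) qt)

module Cyclic where

  open import Data.Nat
  open import Data.Nat.Properties
  open import Data.Nat.DivMod hiding (_mod_)
  open import Relation.Binary.PropositionalEquality
  open import Algebra.Properties.CommutativeSemigroup +-commutativeSemigroup using (xy∙z≈xz∙y)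
  open ≡-Reasoning

  [m%d+n]%d≡[m+n]%d : ∀ m n d .{{_ : NonZero d}} → (m % d + n) % d ≡ (m + n) % d
  [m%d+n]%d≡[m+n]%d m n d = begin
    (m % d + n) % d           ≡⟨ %-distribˡ-+ (m % d) n d ⟩
    (m % d % d + n % d) % d   ≡⟨ cong (λ x → (x + n % d) % d) (m%n%n≡m%n m d) ⟩
    (m % d + n % d) % d       ≡⟨ %-distribˡ-+ m n d ⟨
    (m + n) % d               ∎

  [m+n%d]%d≡[m+n]%d : ∀ m n d .{{_ : NonZero d}} → (m + n % d) % d ≡ (m + n) % d
  [m+n%d]%d≡[m+n]%d m n d = begin
    (m + n % d) % d  ≡⟨ cong (_% d) (+-comm m (n % d)) ⟩
    (n % d + m) % d  ≡⟨ [m%d+n]%d≡[m+n]%d n m d ⟩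
    (n + m) % d      ≡⟨ cong (_% d) (+-comm n m) ⟩
    (m + n) % d      ∎

  m+o+[n∸m]≡o+n : ∀ {m n} o → m ≤ n → m + o + (n ∸ m) ≡ o + n
  m+o+[n∸m]≡o+n {m} {n} o m≤n = begin
    m + o + (n ∸ m)    ≡⟨ cong (_+ (n ∸ m)) (+-comm m o) ⟩
    o + m + (n ∸ m)    ≡⟨ +-assoc o m (n ∸ m) ⟩
    o + (m + (n ∸ m))  ≡⟨ cong (o +_) (m+[n∸m]≡n m≤n) ⟩
    o + n              ∎

  -- k − i modulo n, for i ≤ n (adding n ∸ i rather than subtracting i avoids truncation).
  offset : ℕ → ℕ → ℕ → ℕ
  offset n i k = (k + (n ∸ i)) mod n

  next prev : ℕ → ℕ → ℕ
  next n x = suc x mod n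
  prev n x = (x + (n ∸ 1)) mod n

  module _ {m : ℕ} where

    private
      n : ℕ
      n = suc m

    [x+n]%n≡x : ∀ {x} → x < n → (x + n) % n ≡ x
    [x+n]%n≡x {x} x<n = trans ([m+n]%n≡m%n x n) (m<n⇒m%n≡m x<n)

    offset<n : ∀ i k → offset n i k < n
    offset<n i k = m%n<n (k + (n ∸ i)) n

    offset-spec : ∀ {i k x} → i ≤ n → k < n → x < n → ((i + x) % n ≡ k) ⇔ (x ≡ offset n i k)
    offset-spec {i} {k} {x} i≤n k<n x<n = mk⇔ to from
      where
      to : (i + x) % n ≡ k → x ≡ offset n i k
      to i+x≡k = begin
        x                             ≡⟨ [x+n]%n≡x x<n ⟨
        (x + n) % n                   ≡⟨ cong (_% n) (m+o+[n∸m]≡o+n x i≤n) ⟨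
        (i + x + (n ∸ i)) % n         ≡⟨ [m%d+n]%d≡[m+n]%d (i + x) (n ∸ i) n ⟨
        ((i + x) % n + (n ∸ i)) % n   ≡⟨ cong (λ y → (y + (n ∸ i)) % n) i+x≡k ⟩
        offset n i k                  ∎
      from : x ≡ offset n i k → (i + x) % n ≡ k
      from x≡offset = begin
        (i + x) % n                   ≡⟨ cong (λ y → (i + y) % n) x≡offset ⟩
        (i + (k + (n ∸ i)) % n) % n   ≡⟨ [m+n%d]%d≡[m+n]%d i (k + (n ∸ i)) n ⟩
        (i + (k + (n ∸ i))) % n       ≡⟨ cong (_% n) (+-assoc i k (n ∸ i)) ⟨
        (i + k + (n ∸ i)) % n         ≡⟨ cong (_% n) (m+o+[n∸m]≡o+n k i≤n) ⟩
        (k + n) % n                   ≡⟨ [x+n]%n≡x k<n ⟩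
        k                             ∎

    [k+y]%n≡i⇒[i+[n∸y]]%n≡k : ∀ {i k y} → y ≤ n → k < n →
                              (k + y) % n ≡ i → (i + (n ∸ y)) % n ≡ k
    [k+y]%n≡i⇒[i+[n∸y]]%n≡k {i} {k} {y} y≤n k<n k+y≡i = begin
      (i + (n ∸ y)) % n              ≡⟨ cong (λ z → (z + (n ∸ y)) % n) k+y≡i ⟨
      ((k + y) % n + (n ∸ y)) % n    ≡⟨ [m%d+n]%d≡[m+n]%d (k + y) (n ∸ y) n ⟩
      (k + y + (n ∸ y)) % n          ≡⟨ cong (_% n) (+-assoc k y (n ∸ y)) ⟩
      (k + (y + (n ∸ y))) % n        ≡⟨ cong (λ z → (k + z) % n) (m+[n∸m]≡n y≤n) ⟩
      (k + n) % n                    ≡⟨ [x+n]%n≡x k<n ⟩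
      k                              ∎

    offset-spec-reflected : ∀ {i k y} → i < n → k < n → 0 < y → y < n →
                            ((k + y) % n ≡ i) ⇔ (n ∸ y ≡ offset n i k)
    offset-spec-reflected {i} {k} {y} i<n k<n 0<y y<n = mk⇔
      (λ k+y≡i → Equivalence.to spec ([k+y]%n≡i⇒[i+[n∸y]]%n≡k (<⇒≤ y<n) k<n k+y≡i))
      (λ n∸y≡offset → subst (λ z → (k + z) % n ≡ i) (m∸[m∸n]≡n (<⇒≤ y<n))
        ([k+y]%n≡i⇒[i+[n∸y]]%n≡k (m∸n≤m n y) i<n (Equivalence.from spec n∸y≡offset)))
      where spec = offset-spec (<⇒≤ i<n) k<n (∸-monoʳ-< 0<y (<⇒≤ y<n))

    ≡⇔offset≡0 : ∀ {i k} → i < n → k < n → (i ≡ k) ⇔ (offset n i k ≡ 0)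
    ≡⇔offset≡0 {i} {k} i<n k<n = mk⇔
      (λ i≡k → sym (Equivalence.to spec (trans i+0%n≡i i≡k)))
      (λ offset≡0 → trans (sym i+0%n≡i) (Equivalence.from spec (sym offset≡0)))
      where
      spec = offset-spec (<⇒≤ i<n) k<n (s≤s z≤n)
      i+0%n≡i : (i + 0) % n ≡ i
      i+0%n≡i = trans (cong (_% n) (+-identityʳ i)) (m<n⇒m%n≡m i<n)

    offset-next : ∀ i k → offset n i (next n k) ≡ next n (offset n i k)
    offset-next i k = trans ([m%d+n]%d≡[m+n]%d (suc k) (n ∸ i) n)
                            (sym ([m+n%d]%d≡[m+n]%d 1 (k + (n ∸ i)) n))

    offset-prev : ∀ i k → offset n i (prev n k) ≡ prev n (offset n i k)
    offset-prev i k = begin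
      ((k + m) % n + (n ∸ i)) % n   ≡⟨ [m%d+n]%d≡[m+n]%d (k + m) (n ∸ i) n ⟩
      (k + m + (n ∸ i)) % n         ≡⟨ cong (_% n) (xy∙z≈xz∙y k m (n ∸ i)) ⟩
      (k + (n ∸ i) + m) % n         ≡⟨ [m%d+n]%d≡[m+n]%d (k + (n ∸ i)) m n ⟨
      ((k + (n ∸ i)) % n + m) % n   ∎

    next<n : ∀ x → next n x < n
    next<n x = m%n<n (suc x) n

    prev<n : ∀ x → prev n x < n
    prev<n x = m%n<n (x + m) n

    next-prev : ∀ {k} → k < n → next n (prev n k) ≡ k
    next-prev {k} k<n = begin
      suc ((k + m) % n) % n  ≡⟨ [m+n%d]%d≡[m+n]%d 1 (k + m) n ⟩
      suc (k + m) % n        ≡⟨ cong (_% n) (+-suc k m) ⟨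
      (k + n) % n            ≡⟨ [x+n]%n≡x k<n ⟩
      k                      ∎

    prev-next : ∀ {k} → k < n → prev n (next n k) ≡ k
    prev-next {k} k<n = begin
      (suc k % n + m) % n  ≡⟨ [m%d+n]%d≡[m+n]%d (suc k) m n ⟩
      suc (k + m) % n      ≡⟨ cong (_% n) (+-suc k m) ⟨
      (k + n) % n          ≡⟨ [x+n]%n≡x k<n ⟩
      k                    ∎

    next≡⇔≡prev : ∀ {k j} → k < n → j < n → (next n k ≡ j) ⇔ (k ≡ prev n j)
    next≡⇔≡prev k<n j<n = mk⇔
      (λ next≡j → trans (sym (prev-next k<n)) (cong (prev n) next≡j))
      (λ k≡prev → trans (cong (next n) k≡prev) (next-prev j<n))

    prev-zero : prev n 0 ≡ m
    prev-zero = m<n⇒m%n≡m (n<1+n m)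

    prev-suc : ∀ {x} → suc x < n → prev n (suc x) ≡ x
    prev-suc {x} x+1<n = trans (cong (_% n) (sym (+-suc x m))) ([x+n]%n≡x (<-trans (n<1+n x) x+1<n))

    next-< : ∀ {x} → suc x < n → next n x ≡ suc x
    next-< = m<n⇒m%n≡m

    next-last : next n m ≡ 0
    next-last = n%n≡0 n

open Cyclic

module Connections where

  open import Data.Bool using (true; false; _∨_)
  open import Data.Bool.Properties using (T-∨; ∨-comm)
  open import Data.Bool.ListAction using (or)
  open import Data.List.Properties using (map-cong)
  open import Data.Nat
  open import Data.Nat.Properties
  open import Data.Nat.Tactic.RingSolver using (solve-∀)
  open import Data.Sum using (_⊎_; inj₁; inj₂)
  open import Data.Sum.Function.Propositional using (_⊎-⇔_)
  open import Function.Base using (_∘′_)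
  open import Relation.Binary.PropositionalEquality
  open import Relation.Nullary.Decidable using (yes; no)

  oneMod3 : ℕ → Bool
  oneMod3 0 = false
  oneMod3 1 = true
  oneMod3 2 = false
  oneMod3 (suc (suc (suc r))) = oneMod3 r

  oneMod3-3q : ∀ q → oneMod3 (3 * q) ≡ false
  oneMod3-3q zero    = refl
  oneMod3-3q (suc q) = trans (cong oneMod3 (*-suc 3 q)) (oneMod3-3q q)

  oneMod3-1+3q : ∀ q → oneMod3 (1 + 3 * q) ≡ true
  oneMod3-1+3q zero    = refl
  oneMod3-1+3q (suc q) = trans (cong (oneMod3 ∘′ suc) (*-suc 3 q)) (oneMod3-1+3q q)

  oneMod3⇒≡1+3q : ∀ r → T (oneMod3 r) → ∃[ q ] r ≡ 1 + 3 * q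
  oneMod3⇒≡1+3q 1 _ = 0 , refl
  oneMod3⇒≡1+3q (suc (suc (suc r))) h with oneMod3⇒≡1+3q r h
  ... | q , r≡1+3q = suc q , trans (cong (3 +_) r≡1+3q) (cong suc (sym (*-suc 3 q)))

  n≤⌈n/2⌉+⌈n/2⌉ : ∀ n → n ≤ ⌈ n /2⌉ + ⌈ n /2⌉
  n≤⌈n/2⌉+⌈n/2⌉ n = begin
    n                    ≡⟨ ⌊n/2⌋+⌈n/2⌉≡n n ⟨
    ⌊ n /2⌋ + ⌈ n /2⌉    ≤⟨ +-monoˡ-≤ ⌈ n /2⌉ (⌊n/2⌋≤⌈n/2⌉ n) ⟩
    ⌈ n /2⌉ + ⌈ n /2⌉    ∎
    where open ≤-Reasoning

  -- N (suc e), written so that it is visibly a successor; the paper's d is suc e throughout.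
  N′ : ℕ → ℕ
  N′ e = 2 + 3 * e

  ΓOffset : ℕ → ℕ → Set
  ΓOffset e r = ∃[ t ] t < ⌈ suc e /2⌉ × (3 * t + 1 ≡ r ⊎ N′ e ∸ (3 * t + 1) ≡ r)

  <⌈1+e/2⌉⇒≤e : ∀ {t e} → t < ⌈ suc e /2⌉ → t ≤ e
  <⌈1+e/2⌉⇒≤e {t} {e} t<c = ≤-pred (≤-trans t<c (⌈n/2⌉≤n (suc e)))

  3t+1<2+3e : ∀ {t e} → t ≤ e → 3 * t + 1 < N′ e
  3t+1<2+3e {t} {e} t≤e = s≤s (subst (_≤ suc (3 * e)) (+-comm 1 (3 * t)) (s≤s (*-monoʳ-≤ 3 t≤e)))

  2+3e∸[3t+1]≡3[e∸t]+1 : ∀ {t e} → t ≤ e → N′ e ∸ (3 * t + 1) ≡ 3 * (e ∸ t) + 1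
  2+3e∸[3t+1]≡3[e∸t]+1 {t} {e} t≤e = begin
    2 + 3 * e ∸ (3 * t + 1)
      ≡⟨ cong (λ x → 2 + 3 * x ∸ (3 * t + 1)) (m+[n∸m]≡n t≤e) ⟨
    2 + 3 * (t + s) ∸ (3 * t + 1)
      ≡⟨ cong (_∸ (3 * t + 1)) (split t s) ⟩
    (3 * t + 1) + (3 * s + 1) ∸ (3 * t + 1)
      ≡⟨ m+n∸m≡n (3 * t + 1) (3 * s + 1) ⟩
    3 * s + 1 ∎
    where
    open ≡-Reasoning
    s = e ∸ t
    split : ∀ t s → 2 + 3 * (t + s) ≡ (3 * t + 1) + (3 * s + 1)
    split = solve-∀

  ΓOffset⇔oneMod3 : ∀ {e r} → r < N′ e → ΓOffset e r ⇔ T (oneMod3 r)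
  ΓOffset⇔oneMod3 {e} {r} r<n = mk⇔ to from
    where
    c = ⌈ suc e /2⌉
    oneMod3-3t+1 : ∀ t → T (oneMod3 (3 * t + 1))
    oneMod3-3t+1 t = Equivalence.from T-≡ (trans (cong oneMod3 (+-comm (3 * t) 1)) (oneMod3-1+3q t))
    to : ΓOffset e r → T (oneMod3 r)
    to (t , t<c , inj₁ refl) = oneMod3-3t+1 t
    to (t , t<c , inj₂ refl) =
      subst (T ∘′ oneMod3) (sym (2+3e∸[3t+1]≡3[e∸t]+1 (<⌈1+e/2⌉⇒≤e t<c))) (oneMod3-3t+1 (e ∸ t))
    -- r = 3q + 1 with q ≤ e; if q is not below c, then the mirror offset e ∸ q is, as e < c + c.
    from : T (oneMod3 r) → ΓOffset e r
    from h with oneMod3⇒≡1+3q r h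
    ... | q , r≡1+3q with q <? c
    ...   | yes q<c = q , q<c , inj₁ (trans (+-comm (3 * q) 1) (sym r≡1+3q))
    ...   | no  q≮c = e ∸ q , e∸q<c , inj₂ (begin
            N′ e ∸ (3 * (e ∸ q) + 1)   ≡⟨ 2+3e∸[3t+1]≡3[e∸t]+1 (m∸n≤m e q) ⟩
            3 * (e ∸ (e ∸ q)) + 1      ≡⟨ cong (λ x → 3 * x + 1) (m∸[m∸n]≡n q≤e) ⟩
            3 * q + 1                  ≡⟨ +-comm (3 * q) 1 ⟩
            1 + 3 * q                  ≡⟨ r≡1+3q ⟨
            r                          ∎)
      where
      open ≡-Reasoning
      q≤e : q ≤ e
      q≤e = *-cancelˡ-≤ 3 (≤-pred (≤-pred (subst (_< N′ e) r≡1+3q r<n)))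
      e∸q<c : e ∸ q < c
      e∸q<c = ≤-<-trans (∸-monoʳ-≤ e (≮⇒≥ q≮c))
                        (m<n+o⇒m∸n<o e c (n≤⌈n/2⌉+⌈n/2⌉ (suc e)))

  -- edgeΓ d i k is, by definition, edgeℕ (N d) ⌈ d /2⌉ (toℕ i) (toℕ k).
  edgeℕ : ℕ → ℕ → ℕ → ℕ → Bool
  edgeℕ n c i k =
    any (λ t → ⌊ (i + (3 * t + 1)) mod n ≟ k ⌋ ∨ ⌊ (k + (3 * t + 1)) mod n ≟ i ⌋) (upTo c)

  edgeℕ-sym : ∀ n c i k → edgeℕ n c i k ≡ edgeℕ n c k i
  edgeℕ-sym n c i k = cong or (map-cong (λ t → ∨-comm ⌊ (i + (3 * t + 1)) mod n ≟ k ⌋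
                                                       ⌊ (k + (3 * t + 1)) mod n ≟ i ⌋) (upTo c))

  T-edgeℕ⇔ΓOffset : ∀ {e i k} → i < N′ e → k < N′ e →
                    T (edgeℕ (N′ e) ⌈ suc e /2⌉ i k) ⇔ ΓOffset e (offset (N′ e) i k)
  T-edgeℕ⇔ΓOffset {e} {i} {k} i<n k<n = ∃<-cong offset-cases ⇔-∘ T-any-upTo _ ⌈ suc e /2⌉
    where
    offset-cases : ∀ {t} → t < ⌈ suc e /2⌉ →
      T (⌊ (i + (3 * t + 1)) % N′ e ≟ k ⌋ ∨ ⌊ (k + (3 * t + 1)) % N′ e ≟ i ⌋) ⇔
      (3 * t + 1 ≡ offset (N′ e) i k ⊎ N′ e ∸ (3 * t + 1) ≡ offset (N′ e) i k)
    offset-cases {t} t<c =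
      (offset-spec (<⇒≤ i<n) k<n y<n ⊎-⇔ offset-spec-reflected i<n k<n (m≤n+m 1 (3 * t)) y<n)
        ⇔-∘ ((T-⌊≟⌋ ⊎-⇔ T-⌊≟⌋) ⇔-∘ T-∨)
      where y<n = 3t+1<2+3e (<⌈1+e/2⌉⇒≤e t<c)

  -- Stated for any n equal to N′ e, since N (suc e) ≡ N′ e holds only propositionally.
  edgeℕ-circulant : ∀ e {n i k} → n ≡ N′ e → i < n → k < n →
                    edgeℕ n ⌈ suc e /2⌉ i k ≡ oneMod3 (offset n i k)
  edgeℕ-circulant e {i = i} {k} refl i<n k<n =
    T-⇔⇒≡ (ΓOffset⇔oneMod3 {e} (offset<n i k) ⇔-∘ T-edgeℕ⇔ΓOffset {e} i<n k<n)

open Connections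

open import Algebra.Bundles using (CommutativeRing; CommutativeMonoid)
open import Data.Fin using (Fin; toℕ)
open import Data.Fin.Properties using (toℕ<n)
open import Data.Nat using (zero; suc; s≤s; _<?_; ⌈_/2⌉)
import Data.Nat.Properties as ℕ
open import Data.Nat.Coprimality using (1-coprimeTo)
import Data.Nat.Coprimality as Coprime
open import Data.Integer using (+_)
import Data.Integer as ℤ
import Data.Integer.Properties as ℤ
open import Data.Rational using (ℚ; 0ℚ; 1ℚ; _+_; _-_; _*_; _/_; -_; mkℚ; Positive)
open import Data.Rational.Properties
  using (+-*-commutativeRing; +-0-commutativeMonoid; +-comm; +-identityˡ; +-identityʳ;
         *-comm; *-identityˡ; *-identityʳ; *-zeroʳ; *-distribˡ-+; neg-distribˡ-*; *-inverseˡ;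
         ≤-antisym; ≤-reflexive; *-cancelʳ-≤-pos; normalize-coprime; /-cong; 0/n≡0)
open import Data.Rational.Solver using (module +-*-Solver)
open import Function.Base using (_∘_)
open import Relation.Binary.PropositionalEquality using (refl; cong; cong₂; module ≡-Reasoning)
open import Relation.Nullary.Decidable using (yes; no)
open import Algebra.Properties.Semiring.Sum (CommutativeRing.semiring +-*-commutativeRing)
  using (sum; sum-cong-≗; ∑-distrib-+; ∑-comm; *-distribˡ-sum; *-distribʳ-sum;
         sum-replicate; sum-replicate-zero)
open import Algebra.Properties.Semiring.Mult (CommutativeRing.semiring +-*-commutativeRing)
  using (×1-homo-*) renaming (_×_ to _×ℚ_)
open import Algebra.Properties.CommutativeSemigroup
  (CommutativeMonoid.commutativeSemigroup +-0-commutativeMonoid) using (xy∙z≈xz∙y)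

*-cancelʳ-≡-pos : ∀ {p q} r .{{_ : Positive r}} → p * r ≡ q * r → p ≡ q
*-cancelʳ-≡-pos r pr≡qr =
  ≤-antisym (*-cancelʳ-≤-pos r (≤-reflexive pr≡qr)) (*-cancelʳ-≤-pos r (≤-reflexive (sym pr≡qr)))

n×1ℚ≡n/1 : ∀ n → n ×ℚ 1ℚ ≡ + n / 1
n×1ℚ≡n/1 zero    = sym (0/n≡0 1)
n×1ℚ≡n/1 (suc n) = begin
  1ℚ + n ×ℚ 1ℚ          ≡⟨ cong (_+_ 1ℚ) (trans (n×1ℚ≡n/1 n) (normalize-coprime n∣1)) ⟩
  1ℚ + mkℚ (+ n) 0 n∣1  ≡⟨ /-cong (cong (ℤ._+_ (+ 1)) (ℤ.*-identityʳ (+ n))) refl ⟩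
  + suc n / 1           ∎
  where
  open ≡-Reasoning
  n∣1 = Coprime.sym (1-coprimeTo n)

1/n*[n×1ℚ]≡1 : ∀ n .{{_ : NonZero n}} → (+ 1 / n) * (n ×ℚ 1ℚ) ≡ 1ℚ
1/n*[n×1ℚ]≡1 (suc n) = begin
  (+ 1 / suc n) * (suc n ×ℚ 1ℚ)
    ≡⟨ cong₂ _*_ (normalize-coprime (1-coprimeTo (suc n)))
                 (trans (n×1ℚ≡n/1 (suc n)) (normalize-coprime 1+n∣1)) ⟩
  mkℚ (+ 1) n (1-coprimeTo (suc n)) * p
    ≡⟨ *-inverseˡ p ⟩
  1ℚ ∎
  where
  open ≡-Reasoning
  1+n∣1 = Coprime.sym (1-coprimeTo (suc n))
  p = mkℚ (+ suc n) 0 1+n∣1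

sumFin≡sum : ∀ n (f : Fin n → ℚ) → sumFin n f ≡ sum f
sumFin≡sum zero    f = refl
sumFin≡sum (suc n) f = cong (_+_ (f Fin.zero)) (sumFin≡sum n (f ∘ Fin.suc))
  where import Data.Fin as Fin

∑-indicator : ∀ {n} (g : ℕ → ℚ) {x} → x ℕ.< n →
              sum {n} (λ k → g (toℕ k) * boolℚ ⌊ toℕ k ℕ.≟ x ⌋) ≡ g x
∑-indicator {suc n} g {zero} _ = begin
  g 0 * 1ℚ + sum {n} (λ k → g (suc (toℕ k)) * 0ℚ)
    ≡⟨ cong₂ _+_ (*-identityʳ (g 0)) (sum-cong-≗ {n} (λ k → *-zeroʳ (g (suc (toℕ k))))) ⟩
  g 0 + sum {n} (λ _ → 0ℚ)    ≡⟨ cong (_+_ (g 0)) (sum-replicate-zero n) ⟩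
  g 0 + 0ℚ                    ≡⟨ +-identityʳ (g 0) ⟩
  g 0                         ∎
  where open ≡-Reasoning
∑-indicator {suc n} g {suc x} (s≤s x<n) = begin
  g 0 * 0ℚ + sum {n} (λ k → g (suc (toℕ k)) * boolℚ ⌊ suc (toℕ k) ℕ.≟ suc x ⌋)
    ≡⟨ cong₂ _+_ (*-zeroʳ (g 0))
                 (sum-cong-≗ {n} (λ k → cong (λ b → g (suc (toℕ k)) * boolℚ b)
                                             (⌊⌋-⇔ suc-⇔ _ _))) ⟩
  0ℚ + sum {n} (λ k → g (suc (toℕ k)) * boolℚ ⌊ toℕ k ℕ.≟ x ⌋)
    ≡⟨ +-identityˡ _ ⟩
  sum {n} (λ k → g (suc (toℕ k)) * boolℚ ⌊ toℕ k ℕ.≟ x ⌋)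
    ≡⟨ ∑-indicator (g ∘ suc) x<n ⟩
  g (suc x) ∎
  where
  open ≡-Reasoning
  suc-⇔ : ∀ {a b} → (suc a ≡ suc b) ⇔ (a ≡ b)
  suc-⇔ = mk⇔ ℕ.suc-injective (cong suc)

infix 4 _≐_
_≐_ : ∀ {n} → Mat n → Mat n → Set
M ≐ M′ = ∀ i j → M i j ≡ M′ i j

Symmetric : ∀ {n} → Mat n → Set
Symmetric M = M ᵀ ≐ M

rowSum : ∀ {n} → Mat n → Fin n → ℚ
rowSum M i = sum (M i)

rowSum-⊗ : ∀ {n} (M M′ : Mat n) {s} → (∀ k → rowSum M′ k ≡ s) →
           ∀ i → rowSum (M ⊗ M′) i ≡ rowSum M i * s
rowSum-⊗ {n} M M′ {s} rowSum-M′ i = begin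
  sum (λ j → sumFin n (λ k → M i k * M′ k j))
    ≡⟨ sum-cong-≗ {n} (λ j → sumFin≡sum n (λ k → M i k * M′ k j)) ⟩
  sum (λ j → sum (λ k → M i k * M′ k j))
    ≡⟨ ∑-comm {n} {n} (λ j k → M i k * M′ k j) ⟩
  sum (λ k → sum (λ j → M i k * M′ k j))
    ≡⟨ sum-cong-≗ {n} (λ k → *-distribˡ-sum (M i k) (M′ k)) ⟨
  sum (λ k → M i k * rowSum M′ k)
    ≡⟨ sum-cong-≗ {n} (λ k → cong (_*_ (M i k)) (rowSum-M′ k)) ⟩
  sum (λ k → M i k * s)
    ≡⟨ *-distribʳ-sum s (M i) ⟨
  rowSum M i * s ∎
  where open ≡-Reasoning

⊗-⊖-·J : ∀ {n} (M M′ : Mat n) c i j →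
         (M ⊗ (M′ ⊖ (c · J n))) i j ≡ (M ⊗ M′) i j - c * rowSum M i
⊗-⊖-·J {n} M M′ c i j = begin
  sumFin n (λ k → M i k * (M′ k j - c * 1ℚ))
    ≡⟨ sumFin≡sum n (λ k → M i k * (M′ k j - c * 1ℚ)) ⟩
  sum (λ k → M i k * (M′ k j - c * 1ℚ))
    ≡⟨ sum-cong-≗ {n} (λ k → expand (M i k) (M′ k j)) ⟩
  sum (λ k → M i k * M′ k j + (- c) * M i k)
    ≡⟨ ∑-distrib-+ (λ k → M i k * M′ k j) (λ k → (- c) * M i k) ⟩
  sum (λ k → M i k * M′ k j) + sum (λ k → (- c) * M i k)
    ≡⟨ cong₂ _+_ (sumFin≡sum n (λ k → M i k * M′ k j)) (*-distribˡ-sum (- c) (M i)) ⟨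
  (M ⊗ M′) i j + (- c) * rowSum M i
    ≡⟨ cong (_+_ ((M ⊗ M′) i j)) (neg-distribˡ-* c (rowSum M i)) ⟨
  (M ⊗ M′) i j - c * rowSum M i ∎
  where
  open ≡-Reasoning
  open +-*-Solver
  expand : ∀ a b → a * (b - c * 1ℚ) ≡ a * b + (- c) * a
  expand a b = solve 3 (λ a b c → a :* (b :- c :* con 1ℚ) := a :* b :+ (:- c) :* a) refl a b c

⊗-ᵀ : ∀ {n} {M M′ : Mat n} → Symmetric M → Symmetric M′ → M′ ⊗ M ≐ (M ⊗ M′) ᵀ
⊗-ᵀ {n} {M} {M′} M-sym M′-sym i j = begin
  sumFin n (λ k → M′ i k * M k j)
    ≡⟨ sumFin≡sum n (λ k → M′ i k * M k j) ⟩
  sum {n} (λ k → M′ i k * M k j)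
    ≡⟨ sum-cong-≗ {n} (λ k → trans (cong₂ _*_ (M′-sym k i) (sym (M-sym k j)))
                                   (*-comm (M′ k i) (M j k))) ⟩
  sum {n} (λ k → M j k * M′ k i)
    ≡⟨ sumFin≡sum n (λ k → M j k * M′ k i) ⟨
  sumFin n (λ k → M j k * M′ k i) ∎
  where open ≡-Reasoning

Id-symmetric : ∀ {n} → Symmetric (Id n)
Id-symmetric i j = cong boolℚ (⌊⌋-⇔ ≡-sym-⇔ _ _)

rowSum-Id : ∀ {n} i → rowSum (Id n) i ≡ 1ℚ
rowSum-Id {n} i = begin
  sum {n} (λ j → Id n i j)
    ≡⟨ sum-cong-≗ {n} (λ j → trans (Id-symmetric j i) (sym (*-identityˡ (Id n j i)))) ⟩
  sum {n} (λ j → 1ℚ * boolℚ ⌊ toℕ j ℕ.≟ toℕ i ⌋)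
    ≡⟨ ∑-indicator (λ _ → 1ℚ) (toℕ<n i) ⟩
  1ℚ ∎
  where open ≡-Reasoning

rowSum-J⊕Id : ∀ {n} i → rowSum (J n ⊕ Id n) i ≡ suc n ×ℚ 1ℚ
rowSum-J⊕Id {n} i = begin
  sum (λ j → 1ℚ + Id n i j)          ≡⟨ ∑-distrib-+ (λ _ → 1ℚ) (Id n i) ⟩
  sum {n} (λ _ → 1ℚ) + sum (Id n i)  ≡⟨ cong₂ _+_ (sum-replicate n) (rowSum-Id i) ⟩
  n ×ℚ 1ℚ + 1ℚ                       ≡⟨ +-comm (n ×ℚ 1ℚ) 1ℚ ⟩
  suc n ×ℚ 1ℚ                        ∎
  where open ≡-Reasoning

W-symmetric : ∀ {n} → Symmetric (W n)
W-symmetric {n} i j = begin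
  Id n j i + P n j i + P n i j  ≡⟨ cong (λ x → x + P n j i + P n i j) (Id-symmetric i j) ⟩
  Id n i j + P n j i + P n i j  ≡⟨ xy∙z≈xz∙y (Id n i j) (P n j i) (P n i j) ⟩
  Id n i j + P n i j + P n j i  ∎
  where open ≡-Reasoning

W-indicators : ∀ {m} (k j : Fin (suc m)) →
  W (suc m) k j ≡ boolℚ ⌊ toℕ k ℕ.≟ toℕ j ⌋ + boolℚ ⌊ toℕ k ℕ.≟ prev (suc m) (toℕ j) ⌋
                                           + boolℚ ⌊ toℕ k ℕ.≟ next (suc m) (toℕ j) ⌋
W-indicators k j = cong₂ (λ a b → boolℚ ⌊ toℕ k ℕ.≟ toℕ j ⌋ + boolℚ a + boolℚ b)
  (⌊⌋-⇔ (next≡⇔≡prev (toℕ<n k) (toℕ<n j)) _ _) (⌊⌋-⇔ ≡-sym-⇔ _ _)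

∑-*W : ∀ {m} (g : ℕ → ℚ) (j : Fin (suc m)) →
  sum (λ k → g (toℕ k) * W (suc m) k j) ≡
  g (toℕ j) + g (prev (suc m) (toℕ j)) + g (next (suc m) (toℕ j))
∑-*W {m} g j = begin
  sum (λ k → g (toℕ k) * W n k j)
    ≡⟨ sum-cong-≗ {n} (λ k → trans (cong (_*_ (g (toℕ k))) (W-indicators k j))
                                   (distrib₃ (g (toℕ k)) (δ x k) (δ x₋ k) (δ x₊ k))) ⟩
  sum (λ k → gδ x k + gδ x₋ k + gδ x₊ k)
    ≡⟨ ∑-distrib-+ (λ k → gδ x k + gδ x₋ k) (gδ x₊) ⟩
  sum (λ k → gδ x k + gδ x₋ k) + sum (gδ x₊)
    ≡⟨ cong (_+ sum (gδ x₊)) (∑-distrib-+ (gδ x) (gδ x₋)) ⟩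
  sum (gδ x) + sum (gδ x₋) + sum (gδ x₊)
    ≡⟨ cong₂ _+_ (cong₂ _+_ (∑-indicator g (toℕ<n j)) (∑-indicator g (prev<n {m} x)))
                 (∑-indicator g (next<n {m} x)) ⟩
  g x + g x₋ + g x₊ ∎
  where
  open ≡-Reasoning
  n = suc m
  x = toℕ j
  x₋ = prev n x
  x₊ = next n x
  δ : ℕ → Fin n → ℚ
  δ y k = boolℚ ⌊ toℕ k ℕ.≟ y ⌋
  gδ : ℕ → Fin n → ℚ
  gδ y k = g (toℕ k) * δ y k
  distrib₃ : ∀ a b c d → a * (b + c + d) ≡ a * b + a * c + a * d
  distrib₃ a b c d = trans (*-distribˡ-+ a (b + c) d) (cong (_+ a * d) (*-distribˡ-+ a b c))

rowSum-W : ∀ {m} k → rowSum (W (suc m)) k ≡ 3 ×ℚ 1ℚ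
rowSum-W {m} k = begin
  sum {suc m} (λ j → W (suc m) k j)
    ≡⟨ sum-cong-≗ {suc m} (λ j → trans (W-symmetric j k) (sym (*-identityˡ (W (suc m) j k)))) ⟩
  sum {suc m} (λ j → 1ℚ * W (suc m) j k)
    ≡⟨ ∑-*W (λ _ → 1ℚ) k ⟩
  3 ×ℚ 1ℚ ∎
  where open ≡-Reasoning

oneMod3ℚ : ℕ → ℚ
oneMod3ℚ r = boolℚ (oneMod3 r)

oneMod3ℚ-three : ∀ r → oneMod3ℚ r + oneMod3ℚ (suc r) + oneMod3ℚ (suc (suc r)) ≡ 1ℚ
oneMod3ℚ-three 0 = refl
oneMod3ℚ-three 1 = refl
oneMod3ℚ-three 2 = refl
oneMod3ℚ-three (suc (suc (suc r))) = oneMod3ℚ-three r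

oneMod3ℚ-window : ∀ e {r} → r ℕ.< N′ e →
  oneMod3ℚ r + oneMod3ℚ (prev (N′ e) r) + oneMod3ℚ (next (N′ e) r) ≡ 1ℚ + boolℚ ⌊ r ℕ.≟ 0 ⌋
oneMod3ℚ-window e {zero} _ =
  cong (λ b → 0ℚ + boolℚ b + 1ℚ) (trans (cong oneMod3 (prev-zero {suc (3 ℕ.* e)})) (oneMod3-1+3q e))
oneMod3ℚ-window e {suc r} r<n with suc (suc r) <? N′ e
... | yes r+2<n = begin
  oneMod3ℚ (suc r) + oneMod3ℚ (prev (N′ e) (suc r)) + oneMod3ℚ (next (N′ e) (suc r))
    ≡⟨ cong₂ (λ a b → oneMod3ℚ (suc r) + oneMod3ℚ a + oneMod3ℚ b) (prev-suc r<n) (next-< r+2<n) ⟩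
  oneMod3ℚ (suc r) + oneMod3ℚ r + oneMod3ℚ (suc (suc r))
    ≡⟨ cong (_+ oneMod3ℚ (suc (suc r))) (+-comm (oneMod3ℚ (suc r)) (oneMod3ℚ r)) ⟩
  oneMod3ℚ r + oneMod3ℚ (suc r) + oneMod3ℚ (suc (suc r))
    ≡⟨ oneMod3ℚ-three r ⟩
  1ℚ ∎
  where open ≡-Reasoning
... | no r+2≮n with ℕ.suc-injective (ℕ.suc-injective (ℕ.≤-antisym r<n (ℕ.≮⇒≥ r+2≮n)))
...   | refl = begin
  oneMod3ℚ m + oneMod3ℚ (prev (N′ e) m) + oneMod3ℚ (next (N′ e) m)
    ≡⟨ cong₂ (λ a b → oneMod3ℚ m + oneMod3ℚ a + oneMod3ℚ b) (prev-suc r<n) (next-last {m}) ⟩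
  oneMod3ℚ m + oneMod3ℚ (3 ℕ.* e) + oneMod3ℚ 0
    ≡⟨ cong₂ (λ a b → boolℚ a + boolℚ b + 0ℚ) (oneMod3-1+3q e) (oneMod3-3q e) ⟩
  1ℚ + 0ℚ + 0ℚ ∎
  where
  open ≡-Reasoning
  m = suc (3 ℕ.* e)

module _ {e : ℕ} (M : Mat (N′ e))
         (M-circulant : ∀ i k → M i k ≡ oneMod3ℚ (offset (N′ e) (toℕ i) (toℕ k))) where

  private
    n = N′ e
    m = suc (3 ℕ.* e)

  circulant⊗W : M ⊗ W n ≐ J n ⊕ Id n
  circulant⊗W i j = begin
    sumFin n (λ k → M i k * W n k j)
      ≡⟨ sumFin≡sum n (λ k → M i k * W n k j) ⟩
    sum (λ k → M i k * W n k j)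
      ≡⟨ sum-cong-≗ {n} (λ k → cong (_* W n k j) (M-circulant i k)) ⟩
    sum (λ k → g (toℕ k) * W n k j)
      ≡⟨ ∑-*W g j ⟩
    g (toℕ j) + g (prev n (toℕ j)) + g (next n (toℕ j))
      ≡⟨ cong₂ (λ a b → g (toℕ j) + oneMod3ℚ a + oneMod3ℚ b)
               (offset-prev {m} (toℕ i) (toℕ j)) (offset-next {m} (toℕ i) (toℕ j)) ⟩
    oneMod3ℚ r + oneMod3ℚ (prev n r) + oneMod3ℚ (next n r)
      ≡⟨ oneMod3ℚ-window e (offset<n {m} (toℕ i) (toℕ j)) ⟩
    1ℚ + boolℚ ⌊ r ℕ.≟ 0 ⌋
      ≡⟨ cong (λ b → 1ℚ + boolℚ b)
              (⌊⌋-⇔ (≡⇔offset≡0 (toℕ<n i) (toℕ<n j)) (toℕ i ℕ.≟ toℕ j) (r ℕ.≟ 0)) ⟨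
    1ℚ + Id n i j ∎
    where
    open ≡-Reasoning
    g : ℕ → ℚ
    g x = oneMod3ℚ (offset n (toℕ i) x)
    r = offset n (toℕ i) (toℕ j)

  -- Every row of W sums to 3, so 3 · rowSum M i = rowSum (J + I) i = N′ e + 1 = 3 (suc e).
  circulant-rowSum : ∀ i → rowSum M i ≡ suc e ×ℚ 1ℚ
  circulant-rowSum i = *-cancelʳ-≡-pos (3 ×ℚ 1ℚ) (begin
    rowSum M i * (3 ×ℚ 1ℚ)     ≡⟨ rowSum-⊗ M (W n) (rowSum-W {m}) i ⟨
    rowSum (M ⊗ W n) i         ≡⟨ sum-cong-≗ {n} (circulant⊗W i) ⟩
    rowSum (J n ⊕ Id n) i      ≡⟨ rowSum-J⊕Id i ⟩
    (3 ℕ.+ 3 ℕ.* e) ×ℚ 1ℚ      ≡⟨ cong (_×ℚ 1ℚ) (ℕ.*-suc 3 e) ⟨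
    (3 ℕ.* suc e) ×ℚ 1ℚ        ≡⟨ ×1-homo-* 3 (suc e) ⟩
    (3 ×ℚ 1ℚ) * (suc e ×ℚ 1ℚ)  ≡⟨ *-comm (3 ×ℚ 1ℚ) (suc e ×ℚ 1ℚ) ⟩
    (suc e ×ℚ 1ℚ) * (3 ×ℚ 1ℚ)  ∎)
    where open ≡-Reasoning

circulant-rightInverse : ∀ e {n} → n ≡ N′ e → (M : Mat n) →
  (∀ i k → M i k ≡ oneMod3ℚ (offset n (toℕ i) (toℕ k))) →
  M ⊗ (W n ⊖ ((+ 1 / suc e) · J n)) ≐ Id n
circulant-rightInverse e {n} refl M M-circulant i j = begin
  (M ⊗ (W n ⊖ (c · J n))) i j
    ≡⟨ ⊗-⊖-·J M (W n) c i j ⟩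
  (M ⊗ W n) i j - c * rowSum M i
    ≡⟨ cong₂ (λ x y → x - c * y) (circulant⊗W {e} M M-circulant i j) (circulant-rowSum {e} M M-circulant i) ⟩
  1ℚ + Id n i j - c * (suc e ×ℚ 1ℚ)
    ≡⟨ cong (λ x → 1ℚ + Id n i j - x) (1/n*[n×1ℚ]≡1 (suc e)) ⟩
  1ℚ + Id n i j - 1ℚ
    ≡⟨ solve 1 (λ x → con 1ℚ :+ x :- con 1ℚ := x) refl (Id n i j) ⟩
  Id n i j ∎
  where
  open ≡-Reasoning
  open +-*-Solver
  c = + 1 / suc e

N-suc : ∀ e → N (suc e) ≡ N′ e
N-suc e = cong (ℕ._∸ 1) (ℕ.*-suc 3 e)

A-circulant : ∀ e (i k : Fin (N (suc e))) →
              A (suc e) i k ≡ oneMod3ℚ (offset (N (suc e)) (toℕ i) (toℕ k))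
A-circulant e i k = cong boolℚ (edgeℕ-circulant e (N-suc e) (toℕ<n i) (toℕ<n k))

A-symmetric : ∀ d → Symmetric (A d)
A-symmetric d i j = cong boolℚ (edgeℕ-sym (N d) ⌈ d /2⌉ (toℕ j) (toℕ i))

lemma5p5 : (d : ℕ) .{{_ : NonZero d}} →
    (∀ i j → (A d ⊗ Ainv d) i j ≡ Id (N d) i j) ×
    (∀ i j → (Ainv d ⊗ A d) i j ≡ Id (N d) i j)
lemma5p5 d@(suc e) = A⊗Ainv≐Id , Ainv⊗A≐Id
  where
  open ≡-Reasoning
  A⊗Ainv≐Id : A d ⊗ Ainv d ≐ Id (N d)
  A⊗Ainv≐Id = circulant-rightInverse e (N-suc e) (A d) (A-circulant e)
  Ainv-symmetric : Symmetric (Ainv d)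
  Ainv-symmetric i j = cong (λ x → x - (+ 1 / d) * 1ℚ) (W-symmetric i j)
  Ainv⊗A≐Id : Ainv d ⊗ A d ≐ Id (N d)
  Ainv⊗A≐Id i j = begin
    (Ainv d ⊗ A d) i j  ≡⟨ ⊗-ᵀ (A-symmetric d) Ainv-symmetric i j ⟩
    (A d ⊗ Ainv d) j i  ≡⟨ A⊗Ainv≐Id j i ⟩
    Id (N d) j i        ≡⟨ Id-symmetric i j ⟩
    Id (N d) i j        ∎
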